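{- For every $k\in\mathbb{N}$, we have $\{n\in\mathbb{Z}\colon |\mathrm{rep}_\mathcal{F}(n)| = 2k+1\} = I_{k}\setminus I_{k-1}$ and $\{\boldsymbol{n}\in\mathbb{Z}^2\colon |\mathrm{rep}_\mathcal{F}(\boldsymbol{n})| = 2k+1\} = I_{k}^2\setminus I_{k-1}^2$, where $I_k = \{i\in\mathbb{Z}\mid -F_{2k}\leq i < F_{2k+1}\}$ for $k\geq0$ and $I_{ -1}=\varnothing$.
   Context: Fibonacci numbers: $F_0=1,F_1=1,F_2=2$, $F_{n+2}=F_{n+1}+F_n$. Let $\Sigma=\{0,1\}$. For an odd-length word $w=w_{2k+1}\cdots w_1$ set $\mathrm{val}_\mathcal{F}(w)=\sum_{i=1}^{2k}w_iF_i-w_{2k+1}F_{2k}$. For $n\in\mathbb{Z}$, $\mathrm{rep}_\mathcal{F}(n)$ is the unique odd-length word $w\in\Sigma(\Sigma\Sigma)^*\setminus(\Sigma^*11\Sigma^*\cup000\Sigma^*\cup101\Sigma^*)$ with $\mathrm{val}_\mathcal{F}(w)=n$. For $\boldsymbol{n}=(n_1,n_2)\in\mathbb{Z}^2$, $\mathrm{rep}_\mathcal{F}(\boldsymbol{n})$ is the two-row word with rows $\mathrm{pad}_t(\mathrm{rep}_\mathcal{F}(n_1))$ and $\mathrm{pad}_t(\mathrm{rep}_\mathcal{F}(n_2))$, where $t=\max\{|\mathrm{rep}_\mathcal{F}(n_1)|,|\mathrm{rep}_\mathcal{F}(n_2)|\}$ and $\mathrm{pad}_t(w)=(00)^{(t-|w|)/2}w$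 if $w$ starts with $0$, $(10)^{(t-|w|)/2}w$ if $w$ starts with $1$. -}

module Defs where

open import Data.Bool using (Bool; true; false)
open import Data.Nat using (ℕ; zero; suc; _+_; _*_; _∸_; _⊔_; _/_)
open import Data.Integer as ℤ using (ℤ; +_; -_)
open import Data.List using (List; []; _∷_; _++_; length; concat; replicate; zip)
open import Data.Product using (_×_; Σ-syntax; ∃-syntax)
open import Data.Empty using (⊥)
open import Relation.Nullary using (¬_)
open import Relation.Binary.PropositionalEquality using (_≡_)

F : ℕ → ℕ
F zero = 1
F (suc zero) = 1
F (suc (suc n)) = F (suc n) + F n

-- Words are lists of bits, most significant letter first:
-- the list  w_m ∷ ... ∷ w_1 ∷ []  represents  w = w_m ⋯ w_1.
Word : Set
Word = List Bool

bit : Bool → ℤ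
bit true = + 1
bit false = + 0

valPos : Word → ℤ
valPos [] = + 0
valPos (b ∷ bs) = bit b ℤ.* (+ F (suc (length bs))) ℤ.+ valPos bs

valF : Word → ℤ
valF [] = + 0
valF (b ∷ bs) = valPos bs ℤ.- bit b ℤ.* (+ F (length bs))

ValidRep : Word → Set
ValidRep w =
  (Σ[ k ∈ ℕ ] length w ≡ suc (2 * k))
  × ¬ (Σ[ u ∈ Word ] Σ[ v ∈ Word ] w ≡ u ++ (true ∷ true ∷ v))
  × ¬ (Σ[ v ∈ Word ] w ≡ false ∷ false ∷ false ∷ v)
  × ¬ (Σ[ v ∈ Word ] w ≡ true ∷ false ∷ true ∷ v)

-- "w = rep_F(n)"  (rep_F(n) is the unique such word)
IsRep : ℤ → Word → Set
IsRep n w = ValidRep w × valF w ≡ n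

pad : ℕ → Word → Word
pad t [] = []
pad t (b ∷ bs) = concat (replicate ((t ∸ suc (length bs)) / 2) (b ∷ false ∷ [])) ++ (b ∷ bs)

Word2 : Set
Word2 = List (Bool × Bool)

IsRep2 : ℤ → ℤ → Word2 → Set
IsRep2 n₁ n₂ W =
  ∃[ w₁ ] ∃[ w₂ ] IsRep n₁ w₁ × IsRep n₂ w₂ ×
    W ≡ zip (pad (length w₁ ⊔ length w₂) w₁) (pad (length w₁ ⊔ length w₂) w₂)

InI : ℕ → ℤ → Set
InI k i = (- (+ F (2 * k))) ℤ.≤ i × i ℤ.< + F (suc (2 * k))

InIpred : ℕ → ℤ → Set
InIpred zero i = ⊥
InIpred (suc k) i = InI k i

-- A word of length 2k+1 ≥ 3 avoiding 11, 000… and 101… is either 0u, with u a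
-- Zeckendorf word of length 2k not starting with 00, or 100u, with u a
-- Zeckendorf word of length 2k−2.  Since the Zeckendorf words of length m have
-- exactly the values [0, F_{m+1}), the first kind has the values
-- [F_{2k−1}, F_{2k+1}) and the second the values [−F_{2k}, −F_{2k−2}): together
-- these form I_k ∖ I_{k−1}.  Padding brings both rows to the longer length, so a
-- pair lies in layer max(k₁, k₂) when its entries lie in layers k₁ and k₂, and
-- the squares I_k² ∖ I_{k−1}² are exactly the pairs with max(k₁, k₂) = k.
module Submission where

open import Defs
open import Data.Bool using (true; false)
open import Data.Nat
  using ( ℕ; zero; suc; _+_; _*_; _∸_; _⊔_; _⊓_; _≤_; _<_; _<?_; z≤n; s≤s; s≤s⁻¹
        ; _≤′_; ≤′-refl; ≤′-step)
open import Data.Nat.Properties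
open import Data.Nat.DivMod using (_/_; m*n/n≡m)
open import Data.Integer as ℤ using (ℤ; +_; -_; -[1+_]; _⊖_)
import Data.Integer.Properties as ℤ
open import Data.List using (List; []; _∷_; _++_; length; concat; replicate; zip)
open import Data.List.Properties using (length-++; length-zipWith)
open import Data.Product using (_×_; _,_; ∃-syntax)
open import Data.Sum using (_⊎_; inj₁; inj₂)
open import Data.Empty using (⊥-elim)
open import Relation.Nullary using (¬_; Dec; yes; no)
open import Relation.Nullary.Decidable using (_×-dec_)
open import Relation.Binary.PropositionalEquality
open import Function.Bundles using (_⇔_; mk⇔; Equivalence)

open Equivalence using (to; from)
open ≡-Reasoning

private
  variable
    a b i j k m v : ℕ
    n n₁ n₂ : ℤ
    w w₁ w₂ : Word

F[n]≤F[1+n] : ∀ n → F n ≤ F (suc n)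
F[n]≤F[1+n] zero = s≤s z≤n
F[n]≤F[1+n] (suc n) = m≤m+n (F (suc n)) (F n)

F-mono-≤′ : i ≤′ j → F i ≤ F j
F-mono-≤′ ≤′-refl = ≤-refl
F-mono-≤′ (≤′-step {j} p) = ≤-trans (F-mono-≤′ p) (F[n]≤F[1+n] j)

F-mono-≤ : i ≤ j → F i ≤ F j
F-mono-≤ p = F-mono-≤′ (≤⇒≤′ p)

data No11 : Word → Set where
  []   : No11 []
  0∷_  : No11 w → No11 (false ∷ w)
  [1]  : No11 (true ∷ [])
  10∷_ : No11 w → No11 (true ∷ false ∷ w)

No11-∷⁻ : ∀ {b} → No11 (b ∷ w) → No11 w
No11-∷⁻ (0∷ p) = p
No11-∷⁻ [1] = []
No11-∷⁻ (10∷ p) = 0∷ p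

Avoids11 : Word → Set
Avoids11 w = ¬ (∃[ u ] ∃[ u′ ] w ≡ u ++ (true ∷ true ∷ u′))

¬No11-11 : ∀ u {u′} → ¬ No11 (u ++ (true ∷ true ∷ u′))
¬No11-11 [] ()
¬No11-11 (false ∷ u) (0∷ p) = ¬No11-11 u p
¬No11-11 (true ∷ []) ()
¬No11-11 (true ∷ false ∷ u) (10∷ p) = ¬No11-11 u p

No11⇒avoids11 : No11 w → Avoids11 w
No11⇒avoids11 p (u , _ , refl) = ¬No11-11 u p

avoids11⇒No11 : ∀ w → Avoids11 w → No11 w
avoids11⇒No11 [] _ = []
avoids11⇒No11 (false ∷ w) h =
  0∷ avoids11⇒No11 w λ (u , u′ , eq) → h (false ∷ u , u′ , cong (false ∷_) eq)
avoids11⇒No11 (true ∷ []) _ = [1]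
avoids11⇒No11 (true ∷ true ∷ w) h = ⊥-elim (h ([] , w , refl))
avoids11⇒No11 (true ∷ false ∷ w) h =
  10∷ avoids11⇒No11 w λ (u , u′ , eq) → h (true ∷ false ∷ u , u′ , cong (λ x → true ∷ false ∷ x) eq)

valFib : Word → ℕ
valFib [] = 0
valFib (false ∷ w) = valFib w
valFib (true ∷ w) = F (suc (length w)) + valFib w

valPos≡valFib : ∀ w → valPos w ≡ + valFib w
valPos≡valFib [] = refl
valPos≡valFib (false ∷ w) = trans (ℤ.+-identityˡ (valPos w)) (valPos≡valFib w)
valPos≡valFib (true ∷ w) rewrite valPos≡valFib w | ℤ.*-identityˡ (+ F (suc (length w))) = refl

valF-0∷ : ∀ w → valF (false ∷ w) ≡ + valFib w
valF-0∷ w rewrite valPos≡valFib w = ℤ.+-identityʳ (+ valFib w)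

valF-100∷ : ∀ u → suc (valFib u) + m ≡ F (2 + length u) → valF (true ∷ false ∷ false ∷ u) ≡ -[1+ m ]
valF-100∷ {m} u eq = begin
  valPos (false ∷ false ∷ u) ℤ.- ℤ.1ℤ ℤ.* + F (2 + length u)
    ≡⟨ cong₂ ℤ._-_ (valPos≡valFib (false ∷ false ∷ u)) (ℤ.*-identityˡ (+ F (2 + length u))) ⟩
  + x ℤ.- + F (2 + length u)   ≡⟨ cong (λ y → + x ℤ.- + y) (trans (sym eq) (sym (+-suc x m))) ⟩
  + x ℤ.- + (x + suc m)        ≡⟨ ℤ.[+m]-[+n]≡m⊖n x (x + suc m) ⟩
  x ⊖ (x + suc m)              ≡⟨ cong (_⊖ (x + suc m)) (sym (+-identityʳ x)) ⟩
  (x + 0) ⊖ (x + suc m)        ≡⟨ ℤ.+-cancelˡ-⊖ x 0 (suc m) ⟩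
  -[1+ m ]                     ∎
  where
  x = valFib u

valFib-< : No11 w → valFib w < F (suc (length w))
valFib-< [] = s≤s z≤n
valFib-< (0∷_ {w} p) = <-≤-trans (valFib-< p) (F[n]≤F[1+n] (suc (length w)))
valFib-< [1] = s≤s (s≤s z≤n)
valFib-< (10∷_ {w} p) = +-monoʳ-< (F (2 + length w)) (valFib-< p)

F≤valFib : ∀ c d u → ¬ (c ≡ false × d ≡ false) → F (suc (length u)) ≤ valFib (c ∷ d ∷ u)
F≤valFib false false u h = ⊥-elim (h (refl , refl))
F≤valFib false true u h = m≤m+n _ _
F≤valFib true d u h = ≤-trans (F[n]≤F[1+n] (suc (length u))) (m≤m+n _ _)

zeckendorf : ∀ m v → v < F (suc m) → ∃[ w ] No11 w × length w ≡ m × valFib w ≡ v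
zeckendorf zero zero _ = [] , [] , refl , refl
zeckendorf zero (suc v) (s≤s ())
zeckendorf (suc m) v v<F with v <? F (suc m)
... | yes v<F′ =
  let w , p , |w| , val = zeckendorf m v v<F′ in false ∷ w , 0∷ p , cong suc |w| , val
zeckendorf (suc zero) v v<2 | no v≮1 =
  true ∷ [] , [1] , refl , ≤-antisym (≮⇒≥ v≮1) (s≤s⁻¹ v<2)
zeckendorf (suc (suc m)) v v<F | no v≮F′ =
  let F≤v = ≮⇒≥ v≮F′
      w , p , |w| , val = zeckendorf m (v ∸ F (2 + m))
        (+-cancelˡ-< (F (2 + m)) _ _ (subst (_< F (3 + m)) (sym (m+[n∸m]≡n F≤v)) v<F))
  in true ∷ false ∷ w , 10∷ p , cong (λ l → 2 + l) |w| ,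
     (begin
       F (2 + length w) + valFib w    ≡⟨ cong₂ (λ l x → F (2 + l) + x) |w| val ⟩
       F (2 + m) + (v ∸ F (2 + m))    ≡⟨ m+[n∸m]≡n F≤v ⟩
       v                              ∎)

<⇔≤-complement : suc v + m ≡ a + b → (v < a ⇔ b ≤ m)
<⇔≤-complement {v} {m} {a} {b} eq = mk⇔
  (λ v<a → +-cancelˡ-≤ a b m (≤-trans (≤-reflexive (sym eq)) (+-monoˡ-≤ m v<a)))
  (λ b≤m → +-cancelʳ-≤ m (suc v) a (≤-trans (≤-reflexive eq) (+-monoʳ-≤ a b≤m)))

m<a⇒∃[o]1+o+m≡a : m < a → ∃[ o ] suc o + m ≡ a
m<a⇒∃[o]1+o+m≡a {m} m<a =
  let o , 1+m+o≡a = m≤n⇒∃[o]m+o≡n m<a in o , trans (cong suc (+-comm o m)) 1+m+o≡a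

-a≤-[1+m]⇔m<a : - (+ a) ℤ.≤ -[1+ m ] ⇔ m < a
-a≤-[1+m]⇔m<a {a = zero} = mk⇔ (λ ()) (λ ())
-a≤-[1+m]⇔m<a {a = suc a} = mk⇔ (λ { (ℤ.-≤- m≤a) → s≤s m≤a }) (λ m<1+a → ℤ.-≤- (s≤s⁻¹ m<1+a))

InLayer : ℕ → ℤ → Set
InLayer k n = InI k n × ¬ InIpred k n

InLayer-zero : InLayer 0 n ⇔ (n ≡ + 0 ⊎ n ≡ -[1+ 0 ])
InLayer-zero = mk⇔ to′ from′
  where
  to′ : InLayer 0 n → n ≡ + 0 ⊎ n ≡ -[1+ 0 ]
  to′ {+ zero} _ = inj₁ refl
  to′ {+ suc v} ((_ , ℤ.+<+ (s≤s ())) , _)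
  to′ { -[1+ zero ]} _ = inj₂ refl
  to′ { -[1+ suc m ]} ((ℤ.-≤- () , _) , _)
  from′ : n ≡ + 0 ⊎ n ≡ -[1+ 0 ] → InLayer 0 n
  from′ (inj₁ refl) = (ℤ.neg-≤-pos , ℤ.+<+ (s≤s z≤n)) , λ ()
  from′ (inj₂ refl) = (ℤ.-≤- z≤n , ℤ.-<+) , λ ()

InLayer-suc-pos : InLayer (suc j) (+ v) ⇔ (F (suc (2 * j)) ≤ v × v < F (3 + 2 * j))
InLayer-suc-pos {j} {v} = mk⇔
  (λ { ((_ , ℤ.+<+ v<F) , ¬InIj) →
         ≮⇒≥ (λ v<F′ → ¬InIj (ℤ.neg-≤-pos , ℤ.+<+ v<F′)) , subst (v <_) F≡ v<F })
  (λ (F≤v , v<F) →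
     (ℤ.neg-≤-pos , ℤ.+<+ (subst (v <_) (sym F≡) v<F)) , λ { (_ , ℤ.+<+ v<F′) → <⇒≱ v<F′ F≤v })
  where
  F≡ : F (suc (2 * suc j)) ≡ F (3 + 2 * j)
  F≡ = cong (λ x → F (suc x)) (*-suc 2 j)

InLayer-suc-neg : InLayer (suc j) -[1+ m ] ⇔ (F (2 * j) ≤ m × m < F (2 + 2 * j))
InLayer-suc-neg {j} {m} = mk⇔
  (λ ((-F≤ , _) , ¬InIj) →
     ≮⇒≥ (λ m<F → ¬InIj (from -a≤-[1+m]⇔m<a m<F , ℤ.-<+)) , subst (m <_) F≡ (to -a≤-[1+m]⇔m<a -F≤))
  (λ (F≤m , m<F) →
     (from -a≤-[1+m]⇔m<a (subst (m <_) (sym F≡) m<F) , ℤ.-<+) ,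
     λ (-F≤ , _) → <⇒≱ (to -a≤-[1+m]⇔m<a -F≤) F≤m)
  where
  F≡ : F (2 * suc j) ≡ F (2 + 2 * j)
  F≡ = cong F (*-suc 2 j)

InLayer-0∷ : ∀ c d u → No11 (c ∷ d ∷ u) → ¬ (c ≡ false × d ≡ false) → length u ≡ 2 * j →
             InLayer (suc j) (valF (false ∷ c ∷ d ∷ u))
InLayer-0∷ {j} c d u p ¬00 |u| =
  subst (InLayer (suc j)) (sym (valF-0∷ (c ∷ d ∷ u)))
    (from (InLayer-suc-pos {j})
      ( subst (λ l → F (suc l) ≤ valFib (c ∷ d ∷ u)) |u| (F≤valFib c d u ¬00)
      , subst (λ l → valFib (c ∷ d ∷ u) < F (3 + l)) |u| (valFib-< p)))

InLayer-100∷ : ∀ u → No11 u → length u ≡ 2 * j → InLayer (suc j) (valF (true ∷ false ∷ false ∷ u))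
InLayer-100∷ {j} u p |u| =
  let v<F = subst (λ l → valFib u < F (suc l)) |u| (valFib-< p)
      m , 1+v+m≡F = m≤n⇒∃[o]m+o≡n (≤-trans v<F (m≤m+n _ (F (2 * j))))
      valF≡ = valF-100∷ u (subst (λ l → suc (valFib u) + m ≡ F (2 + l)) (sym |u|) 1+v+m≡F)
  in subst (InLayer (suc j)) (sym valF≡)
       (from (InLayer-suc-neg {j})
         ( to (<⇔≤-complement 1+v+m≡F) v<F
         , ≤-trans (s≤s (m≤n+m m (valFib u))) (≤-reflexive 1+v+m≡F)))

rep⇒InLayer : ∀ k w → ValidRep w → length w ≡ suc (2 * k) → InLayer k (valF w)
rep⇒InLayer zero (false ∷ []) _ _ = from InLayer-zero (inj₁ refl)
rep⇒InLayer zero (true ∷ []) _ _ = from InLayer-zero (inj₂ refl)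
rep⇒InLayer zero (_ ∷ _ ∷ _) _ ()
rep⇒InLayer (suc j) w valid |w| = layer w valid (trans |w| (cong suc (*-suc 2 j)))
  where
  layer : ∀ w → ValidRep w → length w ≡ 3 + 2 * j → InLayer (suc j) (valF w)
  layer (false ∷ c ∷ d ∷ u) (_ , no11 , no000 , _) |w| with avoids11⇒No11 _ no11
  ... | 0∷ p = InLayer-0∷ {j} c d u p (λ { (refl , refl) → no000 (u , refl) }) (+-cancelˡ-≡ 3 _ _ |w|)
  layer (true ∷ false ∷ false ∷ u) (_ , no11 , _) |w| with avoids11⇒No11 _ no11
  ... | 10∷ 0∷ p = InLayer-100∷ {j} u p (+-cancelˡ-≡ 3 _ _ |w|)
  layer (true ∷ true ∷ _) (_ , no11 , _) _ = ⊥-elim (no11 ([] , _ , refl))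
  layer (true ∷ false ∷ true ∷ _) (_ , _ , _ , no101) _ = ⊥-elim (no101 (_ , refl))
  layer (_ ∷ []) _ ()
  layer (false ∷ _ ∷ []) _ ()
  layer (true ∷ false ∷ []) _ ()

HasRepLength : ℕ → ℤ → Set
HasRepLength k n = ∃[ w ] (IsRep n w × length w ≡ suc (2 * k))

InLayer-suc-pos⇒rep : F (suc (2 * j)) ≤ v → v < F (3 + 2 * j) → HasRepLength (suc j) (+ v)
InLayer-suc-pos⇒rep {j} {v} F≤v v<F with zeckendorf (2 + 2 * j) v v<F
... | u , p , |u| , refl =
  false ∷ u , (((suc j , |0∷u|) , No11⇒avoids11 (0∷ p) , no000 , λ { (_ , ()) }) , valF-0∷ u) , |0∷u|
  where
  |0∷u| : length (false ∷ u) ≡ suc (2 * suc j)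
  |0∷u| = cong suc (trans |u| (sym (*-suc 2 j)))
  no000 : ¬ (∃[ u′ ] false ∷ u ≡ false ∷ false ∷ false ∷ u′)
  no000 (u′ , refl) =
    <⇒≱ (subst (λ l → valFib u′ < F (suc l)) (+-cancelˡ-≡ 2 _ _ |u|) (valFib-< (No11-∷⁻ (No11-∷⁻ p))))
        F≤v

InLayer-suc-neg⇒rep : F (2 * j) ≤ m → m < F (2 + 2 * j) → HasRepLength (suc j) -[1+ m ]
InLayer-suc-neg⇒rep {j} {m} F≤m m<F with m<a⇒∃[o]1+o+m≡a m<F
... | v , 1+v+m≡F with zeckendorf (2 * j) v (from (<⇔≤-complement 1+v+m≡F) F≤m)
... | u , p , |u| , refl =
  true ∷ false ∷ false ∷ u ,
  (((suc j , |100∷u|) , No11⇒avoids11 (10∷ 0∷ p) , (λ { (_ , ()) }) , (λ { (_ , ()) })) ,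
   valF-100∷ u (subst (λ l → suc (valFib u) + m ≡ F (2 + l)) (sym |u|) 1+v+m≡F)) ,
  |100∷u|
  where
  |100∷u| : length (true ∷ false ∷ false ∷ u) ≡ suc (2 * suc j)
  |100∷u| = trans (cong (λ l → 3 + l) |u|) (cong suc (sym (*-suc 2 j)))

InLayer⇒rep : ∀ k n → InLayer k n → HasRepLength k n
InLayer⇒rep zero n L with to InLayer-zero L
... | inj₁ refl =
  false ∷ [] , (((0 , refl) , No11⇒avoids11 (0∷ []) , (λ { (_ , ()) }) , (λ { (_ , ()) })) , refl) , refl
... | inj₂ refl =
  true ∷ [] , (((0 , refl) , No11⇒avoids11 [1] , (λ { (_ , ()) }) , (λ { (_ , ()) })) , refl) , refl
InLayer⇒rep (suc j) (+ v) L =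
  let F≤v , v<F = to (InLayer-suc-pos {j}) L in InLayer-suc-pos⇒rep F≤v v<F
InLayer⇒rep (suc j) -[1+ m ] L =
  let F≤m , m<F = to (InLayer-suc-neg {j}) L in InLayer-suc-neg⇒rep F≤m m<F

HasRepLength⇔InLayer : HasRepLength k n ⇔ InLayer k n
HasRepLength⇔InLayer {k} {n} = mk⇔
  (λ (w , (valid , valF≡n) , |w|) → subst (InLayer k) valF≡n (rep⇒InLayer k w valid |w|))
  (InLayer⇒rep k n)

InI-mono : j ≤ k → InI j n → InI k n
InI-mono j≤k (-F≤n , n<F) =
  ℤ.≤-trans (ℤ.neg-mono-≤ (ℤ.+≤+ (F-mono-≤ (*-monoʳ-≤ 2 j≤k)))) -F≤n ,
  ℤ.<-≤-trans n<F (ℤ.+≤+ (F-mono-≤ (s≤s (*-monoʳ-≤ 2 j≤k))))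

InI? : ∀ k n → Dec (InI k n)
InI? k n = (- (+ F (2 * k)) ℤ.≤? n) ×-dec (n ℤ.<? + F (suc (2 * k)))

InLayer-level : InI k n → ∃[ j ] InLayer j n
InLayer-level {zero} InI0 = 0 , InI0 , λ ()
InLayer-level {suc k} {n} InI1+k with InI? k n
... | yes InIk = InLayer-level {k} InIk
... | no ¬InIk = suc k , InI1+k , ¬InIk

InLayer⇒InI⇔≤ : InLayer j n → (InI k n ⇔ j ≤ k)
InLayer⇒InI⇔≤ {j} {n} {k} (InIj , ¬InIpred) =
  mk⇔ (λ InIk → ≮⇒≥ (¬k<j InIk)) (λ j≤k → InI-mono j≤k InIj)
  where
  ¬k<j : InI k n → ¬ k < j
  ¬k<j InIk k<j@(s≤s _) = ¬InIpred (InI-mono (s≤s⁻¹ k<j) InIk)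

InLayer⇒InIpred⇔< : InLayer j n → (InIpred k n ⇔ j < k)
InLayer⇒InIpred⇔< {k = zero} _ = mk⇔ (λ ()) (λ ())
InLayer⇒InIpred⇔< {k = suc k} L =
  mk⇔ (λ InIk → s≤s (to (InLayer⇒InI⇔≤ L) InIk)) (λ j<1+k → from (InLayer⇒InI⇔≤ L) (s≤s⁻¹ j<1+k))

InLayer² : ℕ → ℤ → ℤ → Set
InLayer² k n₁ n₂ = (InI k n₁ × InI k n₂) × ¬ (InIpred k n₁ × InIpred k n₂)

InLayer²⇔⊔≡ : InLayer i n₁ → InLayer j n₂ → (InLayer² k n₁ n₂ ⇔ i ⊔ j ≡ k)
InLayer²⇔⊔≡ {i = i} {j = j} {k = k} L₁ L₂ = mk⇔
  (λ ((InI₁ , InI₂) , ¬InIpred²) →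
     ≤-antisym (⊔-lub (to (InI⇔ L₁) InI₁) (to (InI⇔ L₂) InI₂))
               (≮⇒≥ λ i⊔j<k → ¬InIpred² ( from (InIpred⇔ L₁) (m⊔n<o⇒m<o i j i⊔j<k)
                                         , from (InIpred⇔ L₂) (m⊔n<o⇒n<o i j i⊔j<k))))
  (λ { refl → (from (InI⇔ L₁) (m≤m⊔n i j) , from (InI⇔ L₂) (m≤n⊔m i j)) ,
              λ (InIpred₁ , InIpred₂) →
                <-irrefl refl (⊔-lub (to (InIpred⇔ L₁) InIpred₁) (to (InIpred⇔ L₂) InIpred₂)) })
  where
  InI⇔ : ∀ {j n} → InLayer j n → (InI k n ⇔ j ≤ k)
  InI⇔ = InLayer⇒InI⇔≤
  InIpred⇔ : ∀ {j n} → InLayer j n → (InIpred k n ⇔ j < k)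
  InIpred⇔ = InLayer⇒InIpred⇔<

length-concat-replicate : ∀ {A : Set} d (xs : List A) → length (concat (replicate d xs)) ≡ d * length xs
length-concat-replicate zero xs = refl
length-concat-replicate (suc d) xs =
  trans (length-++ xs) (cong (λ l → length xs + l) (length-concat-replicate d xs))

length-pad : ∀ d b u → length (pad (d * 2 + length (b ∷ u)) (b ∷ u)) ≡ d * 2 + length (b ∷ u)
length-pad d b u = begin
  length (concat (replicate e (b ∷ false ∷ [])) ++ b ∷ u)
    ≡⟨ length-++ (concat (replicate e (b ∷ false ∷ []))) ⟩
  length (concat (replicate e (b ∷ false ∷ []))) + length (b ∷ u)
    ≡⟨ cong (_+ length (b ∷ u)) (length-concat-replicate e (b ∷ false ∷ [])) ⟩
  e * 2 + length (b ∷ u)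
    ≡⟨ cong (λ x → x * 2 + length (b ∷ u)) e≡d ⟩
  d * 2 + length (b ∷ u) ∎
  where
  e = (d * 2 + length (b ∷ u) ∸ length (b ∷ u)) / 2
  e≡d : e ≡ d
  e≡d = trans (cong (_/ 2) (m+n∸n≡m (d * 2) (length (b ∷ u)))) (m*n/n≡m d 2)

length-pad-odd : length w ≡ suc (2 * i) → i ≤ k → length (pad (suc (2 * k)) w) ≡ suc (2 * k)
length-pad-odd {w = b ∷ u} {i} {k} |w| i≤k =
  subst (λ t → length (pad t (b ∷ u)) ≡ t) t≡ (length-pad (k ∸ i) b u)
  where
  t≡ : (k ∸ i) * 2 + length (b ∷ u) ≡ suc (2 * k)
  t≡ = begin
    (k ∸ i) * 2 + length (b ∷ u)  ≡⟨ cong (λ l → (k ∸ i) * 2 + l) |w| ⟩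
    (k ∸ i) * 2 + suc (2 * i)     ≡⟨ +-suc ((k ∸ i) * 2) (2 * i) ⟩
    suc ((k ∸ i) * 2 + 2 * i)     ≡⟨ cong (λ x → suc (x + 2 * i)) (*-comm (k ∸ i) 2) ⟩
    suc (2 * (k ∸ i) + 2 * i)     ≡⟨ cong suc (sym (*-distribˡ-+ 2 (k ∸ i) i)) ⟩
    suc (2 * (k ∸ i + i))         ≡⟨ cong (λ x → suc (2 * x)) (m∸n+n≡m i≤k) ⟩
    suc (2 * k)                   ∎

length-zip-pad : length w₁ ≡ suc (2 * i) → length w₂ ≡ suc (2 * j) →
                 let t = length w₁ ⊔ length w₂ in
                 length (zip (pad t w₁) (pad t w₂)) ≡ suc (2 * (i ⊔ j))
length-zip-pad {w₁} {i} {w₂} {j} |w₁| |w₂| = begin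
  length (zip (pad t₀ w₁) (pad t₀ w₂))
    ≡⟨ length-zipWith _,_ (pad t₀ w₁) (pad t₀ w₂) ⟩
  length (pad t₀ w₁) ⊓ length (pad t₀ w₂)
    ≡⟨ cong (λ t → length (pad t w₁) ⊓ length (pad t w₂)) t₀≡t ⟩
  length (pad t w₁) ⊓ length (pad t w₂)
    ≡⟨ cong₂ _⊓_ (length-pad-odd {w = w₁} |w₁| (m≤m⊔n i j))
                 (length-pad-odd {w = w₂} |w₂| (m≤n⊔m i j)) ⟩
  t ⊓ t
    ≡⟨ ⊓-idem t ⟩
  t ∎
  where
  t₀ = length w₁ ⊔ length w₂
  t = suc (2 * (i ⊔ j))
  t₀≡t : t₀ ≡ t
  t₀≡t = trans (cong₂ _⊔_ |w₁| |w₂|) (cong suc (sym (*-distribˡ-⊔ 2 i j)))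

HasRep₂Length : ℕ → ℤ → ℤ → Set
HasRep₂Length k n₁ n₂ = ∃[ W ] (IsRep2 n₁ n₂ W × length W ≡ suc (2 * k))

HasRep₂Length⇔InLayer² : HasRep₂Length k n₁ n₂ ⇔ InLayer² k n₁ n₂
HasRep₂Length⇔InLayer² {k} = mk⇔ rep₂⇒InLayer² InLayer²⇒rep₂
  where
  rep₂⇒InLayer² : HasRep₂Length k n₁ n₂ → InLayer² k n₁ n₂
  rep₂⇒InLayer² (_ , (w₁ , w₂ , r₁@(((i , |w₁|) , _) , _) , r₂@(((j , |w₂|) , _) , _) , refl) , |W|) =
    from (InLayer²⇔⊔≡ (to (HasRepLength⇔InLayer {i}) (w₁ , r₁ , |w₁|))
                      (to (HasRepLength⇔InLayer {j}) (w₂ , r₂ , |w₂|)))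
         (*-cancelˡ-≡ (i ⊔ j) k 2
           (suc-injective (trans (sym (length-zip-pad {w₁} {i} {w₂} {j} |w₁| |w₂|)) |W|)))

  InLayer²⇒rep₂ : InLayer² k n₁ n₂ → HasRep₂Length k n₁ n₂
  InLayer²⇒rep₂ h@((InI₁ , InI₂) , _) =
    let i , L₁ = InLayer-level {k} InI₁
        j , L₂ = InLayer-level {k} InI₂
        w₁ , r₁ , |w₁| = from (HasRepLength⇔InLayer {i}) L₁
        w₂ , r₂ , |w₂| = from (HasRepLength⇔InLayer {j}) L₂
    in _ , (w₁ , w₂ , r₁ , r₂ , refl) ,
       trans (length-zip-pad {w₁} {i} {w₂} {j} |w₁| |w₂|)
             (cong (λ x → suc (2 * x)) (to (InLayer²⇔⊔≡ {k = k} L₁ L₂) h))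

lemma2 : (k : ℕ) →
    ((n : ℤ) →
      (∃[ w ] (IsRep n w × length w ≡ suc (2 * k)))
      ⇔ (InI k n × ¬ InIpred k n))
    × ((n₁ n₂ : ℤ) →
      (∃[ W ] (IsRep2 n₁ n₂ W × length W ≡ suc (2 * k)))
      ⇔ ((InI k n₁ × InI k n₂) × ¬ (InIpred k n₁ × InIpred k n₂)))
lemma2 k = (λ n → HasRepLength⇔InLayer) , (λ n₁ n₂ → HasRep₂Length⇔InLayer²)
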